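{- Let $\mathsf{M}$ be a matroid of rank $k$ with a stressed hyperplane $H$, and let $\widetilde{\mathsf{M}}$ be the relaxation of $\mathsf{M}$ at $H$. Then \[ \mathscr{L}(\widetilde{\mathsf{M}})=\big(\mathscr{L}(\mathsf{M})\smallsetminus\{H\}\big)\sqcup\{A\subseteq H:|A|=k-1\},\] where $\mathscr{L}(\cdot)$ denotes the family of flats.
   Context: A hyperplane of a matroid of rank $k$ is a flat of rank $k-1$; it is stressed if all its subsets of cardinality $k$ are circuits. If $\mathsf{M}=(E,\mathscr{B})$ has a stressed hyperplane $H$, the relaxation of $\mathsf{M}$ at $H$ is the matroid $\widetilde{\mathsf{M}}=(E,\mathscr{B}\sqcup\{S\subseteq H:|S|=k\})$. -}

module Defs where

open import Data.Nat using (ℕ; _≤_; suc)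
import Data.Nat
import Data.Sum
open import Data.Fin using (Fin)
open import Data.Fin.Subset using (Subset; _∈_; _∉_; _⊆_; _⊂_; _∪_; _-_; ⁅_⁆; ∣_∣)
open import Data.Product using (Σ; ∃; _×_; _,_)
open import Relation.Nullary using (¬_)
open import Relation.Unary using (Decidable)
open import Relation.Binary.PropositionalEquality using (_≡_)

Family : ℕ → Set₁
Family n = Subset n → Set

-- A matroid on E = Fin n, given by its family of bases (basis axioms).
-- Decidability of the basis predicate is harmless (classically automatic).
record Matroid (n : ℕ) : Set₁ where
  field
    Base        : Family n
    base-dec    : Decidable Base
    base-exists : ∃ λ B → Base B
    exchange    : ∀ B₁ B₂ → Base B₁ → Base B₂ → ∀ x → x ∈ B₁ → x ∉ B₂ →
                  ∃ λ y → y ∈ B₂ × y ∉ B₁ × Base ((B₁ - x) ∪ ⁅ y ⁆)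
open Matroid public

module _ {n : ℕ} (𝓑 : Family n) where

  Indep : Subset n → Set
  Indep I = ∃ λ B → 𝓑 B × I ⊆ B

  Dependent : Subset n → Set
  Dependent A = ¬ Indep A

  Circuit : Subset n → Set
  Circuit C = Dependent C × (∀ D → D ⊂ C → Indep D)

  HasRankOf : Subset n → ℕ → Set
  HasRankOf A r = (∃ λ I → Indep I × I ⊆ A × ∣ I ∣ ≡ r)
                × (∀ I → Indep I → I ⊆ A → ∣ I ∣ ≤ r)

  IsFlat : Subset n → Set
  IsFlat A = ∀ e → e ∉ A → ∀ r → HasRankOf A r → ¬ HasRankOf (A ∪ ⁅ e ⁆) r

HasRank : ∀ {n} → Matroid n → ℕ → Set
HasRank M k = ∀ B → Base M B → ∣ B ∣ ≡ k

-- in a matroid of rank k+1: a hyperplane is a flat of rank k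
IsHyperplane : ∀ {n} → Matroid n → ℕ → Subset n → Set
IsHyperplane M k H = IsFlat (Base M) H × HasRankOf (Base M) H k

IsStressedHyperplane : ∀ {n} → Matroid n → ℕ → Subset n → Set
IsStressedHyperplane M k H =
  IsHyperplane M k H × (∀ S → S ⊆ H → ∣ S ∣ ≡ Data.Nat.suc k → Circuit (Base M) S)

RelaxedBases : ∀ {n} → Matroid n → ℕ → Subset n → Family n
RelaxedBases M k H S = Base M S Data.Sum.⊎ (S ⊆ H × ∣ S ∣ ≡ Data.Nat.suc k)

-- Independent sets of the relaxation are those of M together with the (k+1)-subsets of H,
-- which are circuits of M; so the two rank functions agree on every set containing no
-- (k+1)-subset of H. A proper flat of M containing one has rank k and contains k independent
-- elements of H, which span the flat H; hence it is H, which contains a basis of the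
-- relaxation and so is no longer a flat there. If A contains no such subset but A ∪ {e} does,
-- then A contains k elements of H; unless A consists of exactly these, adding another element
-- of A to them gives an independent (k+1)-set of M, so A has full rank in both matroids.
-- Conversely a k-subset A of H becomes a flat of the relaxation, since every A ∪ {e} is
-- independent there: a new basis if e ∈ H, and independent in M if e ∉ H because A spans
-- the flat H.
module Submission where

open import Data.Nat using (ℕ; suc; _+_; _≤_; _<_; s≤s; _≤?_)
open import Data.Nat.Properties
open import Data.Vec using ([]; _∷_; here; there)
open import Data.Fin using (Fin; zero; suc)
open import Data.Fin.Subset
open import Data.Fin.Subset.Properties
open import Data.Product using (∃; _×_; _,_; proj₁; proj₂)
open import Data.Sum using (_⊎_; inj₁; inj₂)
open import Data.Empty using (⊥-elim)
open import Function using (_∘_)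
open import Function.Bundles using (_⇔_; mk⇔)
open import Relation.Nullary using (¬_; yes; no)
open import Relation.Nullary.Decidable using (_×-dec_)
open import Relation.Nullary.Negation using (contradiction)
open import Relation.Unary using (Decidable)
open import Relation.Binary.PropositionalEquality
  using (_≡_; _≢_; refl; sym; trans; cong; subst)

open import Defs

private
  variable
    n m : ℕ
    x y : Fin n
    p q : Subset n
    r : ℕ

x∈p─q⇒x∉q : ∀ (p q : Subset n) → x ∈ p ─ q → x ∉ q
x∈p─q⇒x∉q (_ ∷ p) (inside  ∷ q) ()            here
x∈p─q⇒x∉q (_ ∷ p) (outside ∷ q) here          ()
x∈p─q⇒x∉q (_ ∷ p) (_       ∷ q) (there x∈p─q) (there x∈q) = x∈p─q⇒x∉q p q x∈p─q x∈q

x∈p-y⇒x≢y : ∀ (p : Subset n) → x ∈ p - y → x ≢ y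
x∈p-y⇒x≢y {y = y} p x∈p-y refl = x∈p─q⇒x∉q p ⁅ y ⁆ x∈p-y (x∈⁅x⁆ y)

x∈p∪⁅y⁆⁻ : ∀ (p : Subset n) → x ∈ p ∪ ⁅ y ⁆ → x ∈ p ⊎ x ≡ y
x∈p∪⁅y⁆⁻ {y = y} p x∈ with x∈p∪q⁻ p ⁅ y ⁆ x∈
... | inj₁ x∈p   = inj₁ x∈p
... | inj₂ x∈⁅y⁆ = inj₂ (x∈⁅y⁆⇒x≡y y x∈⁅y⁆)

x∈p∪⁅x⁆ : ∀ (p : Subset n) → x ∈ p ∪ ⁅ x ⁆
x∈p∪⁅x⁆ {x = x} p = x∈p∪q⁺ (inj₂ (x∈⁅x⁆ x))

p∪⁅x⁆⊆q : p ⊆ q → x ∈ q → p ∪ ⁅ x ⁆ ⊆ q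
p∪⁅x⁆⊆q {p = p} p⊆q x∈q z∈ with x∈p∪⁅y⁆⁻ p z∈
... | inj₁ z∈p  = p⊆q z∈p
... | inj₂ refl = x∈q

p⊆q∪⁅x⁆⇒p-x⊆q : ∀ (p : Subset n) → p ⊆ q ∪ ⁅ x ⁆ → p - x ⊆ q
p⊆q∪⁅x⁆⇒p-x⊆q {q = q} p p⊆ z∈ with x∈p∪⁅y⁆⁻ q (p⊆ (p─q⊆p p _ z∈))
... | inj₁ z∈q  = z∈q
... | inj₂ refl = contradiction refl (x∈p-y⇒x≢y p z∈)

p⊆q∪⁅x⁆∧x∉p⇒p⊆q : p ⊆ q ∪ ⁅ x ⁆ → x ∉ p → p ⊆ q
p⊆q∪⁅x⁆∧x∉p⇒p⊆q {q = q} p⊆ x∉p z∈p with x∈p∪⁅y⁆⁻ q (p⊆ z∈p)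
... | inj₁ z∈q  = z∈q
... | inj₂ refl = contradiction z∈p x∉p

⊆-or-∃∉ : ∀ (p q : Subset n) → p ⊆ q ⊎ ∃ λ x → x ∈ p × x ∉ q
⊆-or-∃∉ p q with nonempty? (p ─ q)
... | yes (x , x∈p─q) = inj₂ (x , p─q⊆p p q x∈p─q , x∈p─q⇒x∉q p q x∈p─q)
... | no  p─q-empty   = inj₁ λ {z} z∈p → case-∈ z z∈p
  where
  case-∈ : ∀ z → z ∈ p → z ∈ q
  case-∈ z z∈p with z ∈? q
  ... | yes z∈q = z∈q
  ... | no  z∉q = contradiction (z , x∈p∧x∉q⇒x∈p─q z∈p z∉q) p─q-empty

∣p∪⁅x⁆∣≡1+∣p∣ : ∀ (p : Subset n) → x ∉ p → ∣ p ∪ ⁅ x ⁆ ∣ ≡ suc ∣ p ∣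
∣p∪⁅x⁆∣≡1+∣p∣ {x = zero}  (inside  ∷ p) x∉p = contradiction here x∉p
∣p∪⁅x⁆∣≡1+∣p∣ {x = zero}  (outside ∷ p) _   = cong (suc ∘ ∣_∣) (∪-identityʳ p)
∣p∪⁅x⁆∣≡1+∣p∣ {x = suc x} (inside  ∷ p) x∉p = cong suc (∣p∪⁅x⁆∣≡1+∣p∣ p (x∉p ∘ there))
∣p∪⁅x⁆∣≡1+∣p∣ {x = suc x} (outside ∷ p) x∉p = ∣p∪⁅x⁆∣≡1+∣p∣ p (x∉p ∘ there)

∣p-x∣+1≡∣p∣ : ∀ (p : Subset n) → x ∈ p → suc ∣ p - x ∣ ≡ ∣ p ∣
∣p-x∣+1≡∣p∣ (inside  ∷ p) here         = cong (suc ∘ ∣_∣) (p─⊥≡p p)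
∣p-x∣+1≡∣p∣ (inside  ∷ p) (there x∈p) = cong suc (∣p-x∣+1≡∣p∣ p x∈p)
∣p-x∣+1≡∣p∣ (outside ∷ p) (there x∈p) = ∣p-x∣+1≡∣p∣ p x∈p

∣p∪q∣≤∣p∣+∣q∣ : ∀ (p q : Subset n) → ∣ p ∪ q ∣ ≤ ∣ p ∣ + ∣ q ∣
∣p∪q∣≤∣p∣+∣q∣ []            []            = ≤-refl
∣p∪q∣≤∣p∣+∣q∣ (inside  ∷ p) (inside  ∷ q) =
  s≤s (≤-trans (∣p∪q∣≤∣p∣+∣q∣ p q) (+-monoʳ-≤ ∣ p ∣ (n≤1+n ∣ q ∣)))
∣p∪q∣≤∣p∣+∣q∣ (inside  ∷ p) (outside ∷ q) = s≤s (∣p∪q∣≤∣p∣+∣q∣ p q)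
∣p∪q∣≤∣p∣+∣q∣ (outside ∷ p) (inside  ∷ q) =
  subst (suc ∣ p ∪ q ∣ ≤_) (sym (+-suc ∣ p ∣ ∣ q ∣)) (s≤s (∣p∪q∣≤∣p∣+∣q∣ p q))
∣p∪q∣≤∣p∣+∣q∣ (outside ∷ p) (outside ∷ q) = ∣p∪q∣≤∣p∣+∣q∣ p q

∣p∣≡∣p∩q∣+∣p─q∣ : ∀ (p q : Subset n) → ∣ p ∣ ≡ ∣ p ∩ q ∣ + ∣ p ─ q ∣
∣p∣≡∣p∩q∣+∣p─q∣ []            []            = refl
∣p∣≡∣p∩q∣+∣p─q∣ (inside  ∷ p) (inside  ∷ q) = cong suc (∣p∣≡∣p∩q∣+∣p─q∣ p q)
∣p∣≡∣p∩q∣+∣p─q∣ (inside  ∷ p) (outside ∷ q) = trans (cong suc (∣p∣≡∣p∩q∣+∣p─q∣ p q)) (sym (+-suc _ _))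
∣p∣≡∣p∩q∣+∣p─q∣ (outside ∷ p) (inside  ∷ q) = ∣p∣≡∣p∩q∣+∣p─q∣ p q
∣p∣≡∣p∩q∣+∣p─q∣ (outside ∷ p) (outside ∷ q) = ∣p∣≡∣p∩q∣+∣p─q∣ p q

∣p∣≡1+m⇒Nonempty : ∀ (p : Subset n) → ∣ p ∣ ≡ suc m → Nonempty p
∣p∣≡1+m⇒Nonempty (inside  ∷ p) _    = zero , here
∣p∣≡1+m⇒Nonempty (outside ∷ p) ∣p∣≡ with ∣p∣≡1+m⇒Nonempty p ∣p∣≡
... | x , x∈p = suc x , there x∈p

p⊆q∧∣q∣≤∣p∣⇒q⊆p : p ⊆ q → ∣ q ∣ ≤ ∣ p ∣ → q ⊆ p
p⊆q∧∣q∣≤∣p∣⇒q⊆p {p = p} {q} p⊆q ∣q∣≤∣p∣ with ⊆-or-∃∉ q p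
... | inj₁ q⊆p = q⊆p
... | inj₂ x∈q∖p = contradiction (p⊂q⇒∣p∣<∣q∣ (p⊆q , x∈q∖p)) (≤⇒≯ ∣q∣≤∣p∣)

module _ (𝓑 : Family n) where

  RankBound : Subset n → ℕ → Set
  RankBound X r = ∀ I → Indep 𝓑 I → I ⊆ X → ∣ I ∣ ≤ r

  Indep-⊆ : ∀ {I J} → Indep 𝓑 J → I ⊆ J → Indep 𝓑 I
  Indep-⊆ (B , b , J⊆B) I⊆J = B , b , ⊆-trans I⊆J J⊆B

  HasRankOf⇒≤∣_∣ : ∀ X → HasRankOf 𝓑 X r → r ≤ ∣ X ∣
  HasRankOf⇒≤∣ X ∣ ((I , _ , I⊆X , refl) , _) = p⊆q⇒∣p∣≤∣q∣ I⊆X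

  ¬IsFlat-if-spanning : ∀ {A I e} → (∀ J → Indep 𝓑 J → ∣ J ∣ ≤ m) →
    Indep 𝓑 I → I ⊆ A → ∣ I ∣ ≡ m → e ∉ A → ¬ IsFlat 𝓑 A
  ¬IsFlat-if-spanning max i I⊆A ∣I∣≡m e∉A flat = flat _ e∉A _
    ((_ , i , I⊆A , ∣I∣≡m) , λ J j _ → max J j)
    ((_ , i , ⊆-trans I⊆A (p⊆p∪q _) , ∣I∣≡m) , λ J j _ → max J j)

  proper-flat-rank-bound : ∀ {A e k} → (∀ J → Indep 𝓑 J → ∣ J ∣ ≤ suc k) →
    IsFlat 𝓑 A → e ∉ A → RankBound A k
  proper-flat-rank-bound {k = k} max flat e∉A J j J⊆A with ∣ J ∣ ≤? k
  ... | yes ∣J∣≤k = ∣J∣≤k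
  ... | no  ∣J∣≰k = contradiction flat
    (¬IsFlat-if-spanning max j J⊆A (≤-antisym (max J j) (≰⇒> ∣J∣≰k)) e∉A)

  IsFlat-if-insertions-independent : ∀ {A} → (∀ e → e ∉ A → Indep 𝓑 (A ∪ ⁅ e ⁆)) → IsFlat 𝓑 A
  IsFlat-if-insertions-independent {A} indep e e∉A r rank-A (_ , bound-A∪e) =
    <-irrefl refl (begin-strict
      r                  ≤⟨ HasRankOf⇒≤∣ A ∣ rank-A ⟩
      ∣ A ∣               <⟨ n<1+n ∣ A ∣ ⟩
      suc ∣ A ∣           ≡⟨ ∣p∪⁅x⁆∣≡1+∣p∣ A e∉A ⟨
      ∣ A ∪ ⁅ e ⁆ ∣       ≤⟨ bound-A∪e _ (indep e e∉A) ⊆-refl ⟩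
      r                  ∎)
    where open ≤-Reasoning

  flat-⊆-maximal : ∀ {F A} → IsFlat 𝓑 F → HasRankOf 𝓑 F r → F ⊆ A → RankBound A r → A ⊆ F
  flat-⊆-maximal {F = F} flat ((I , i , I⊆F , ∣I∣≡r) , bound-F) F⊆A bound-A {a} a∈A with a ∈? F
  ... | yes a∈F = a∈F
  ... | no  a∉F = ⊥-elim (flat a a∉F _ ((I , i , I⊆F , ∣I∣≡r) , bound-F)
    ((I , i , ⊆-trans I⊆F (p⊆p∪q _) , ∣I∣≡r) ,
     λ J j J⊆F∪a → bound-A J j (⊆-trans J⊆F∪a (p∪⁅x⁆⊆q F⊆A a∈A))))

module _ {𝓑₁ 𝓑₂ : Family n} {X : Subset n} where

  HasRankOf-transfer : (∀ {J} → J ⊆ X → Indep 𝓑₁ J → Indep 𝓑₂ J) →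
    (∀ {J} → J ⊆ X → Indep 𝓑₂ J → Indep 𝓑₁ J) → HasRankOf 𝓑₁ X r → HasRankOf 𝓑₂ X r
  HasRankOf-transfer up down ((I , i , I⊆X , ∣I∣≡r) , bound) =
    (I , up I⊆X i , I⊆X , ∣I∣≡r) , λ J j J⊆X → bound J (down J⊆X j) J⊆X

module _ (M : Matroid n) where

  Indep? : Decidable (Indep (Base M))
  Indep? I = anySubset? (λ B → base-dec M B ×-dec (I ⊆? B))

  basis-between : ∀ {I B₁ B₂} → Base M B₁ → Base M B₂ → I ⊆ B₁ →
    ∃ λ B → Base M B × I ⊆ B × B ⊆ I ∪ B₂
  basis-between {B₁ = B₁} {B₂} = go (suc ∣ B₁ ─ B₂ ∣) (n<1+n _)
    where
    go : ∀ fuel {I B₁} → ∣ B₁ ─ B₂ ∣ < fuel → Base M B₁ → Base M B₂ → I ⊆ B₁ →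
         ∃ λ B → Base M B × I ⊆ B × B ⊆ I ∪ B₂
    go (suc fuel) {I} {B₁} (s≤s ∣B₁─B₂∣≤fuel) b₁ b₂ I⊆B₁ with ⊆-or-∃∉ B₁ (I ∪ B₂)
    ... | inj₁ B₁⊆I∪B₂ = B₁ , b₁ , I⊆B₁ , B₁⊆I∪B₂
    ... | inj₂ (x , x∈B₁ , x∉I∪B₂) with exchange M B₁ B₂ b₁ b₂ x x∈B₁ (x∉I∪B₂ ∘ q⊆p∪q I B₂)
    ... | y , y∈B₂ , _ , b′ =
      go fuel (<-≤-trans (≤-<-trans (p⊆q⇒∣p∣≤∣q∣ B′─B₂⊆) (x∈p⇒∣p-x∣<∣p∣ x∈B₁─B₂)) ∣B₁─B₂∣≤fuel)
         b′ b₂ I⊆B′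
      where
      B′ = (B₁ - x) ∪ ⁅ y ⁆
      x∈B₁─B₂ : x ∈ B₁ ─ B₂
      x∈B₁─B₂ = x∈p∧x∉q⇒x∈p─q x∈B₁ (x∉I∪B₂ ∘ q⊆p∪q I B₂)
      I⊆B′ : I ⊆ B′
      I⊆B′ z∈I = p⊆p∪q ⁅ y ⁆ (x∈p∧x≢y⇒x∈p-y (I⊆B₁ z∈I) λ { refl → x∉I∪B₂ (p⊆p∪q B₂ z∈I) })
      B′─B₂⊆ : B′ ─ B₂ ⊆ (B₁ ─ B₂) - x
      B′─B₂⊆ z∈ with x∈p∪⁅y⁆⁻ (B₁ - x) (p─q⊆p B′ B₂ z∈)
      ... | inj₁ z∈B₁-x = x∈p∧x≢y⇒x∈p-y
              (x∈p∧x∉q⇒x∈p─q (p─q⊆p B₁ _ z∈B₁-x) (x∈p─q⇒x∉q B′ B₂ z∈)) (x∈p-y⇒x≢y B₁ z∈B₁-x)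
      ... | inj₂ refl = contradiction y∈B₂ (x∈p─q⇒x∉q B′ B₂ z∈)

  module _ (rank : HasRank M m) where

    Indep⇒≤rank : ∀ J → Indep (Base M) J → ∣ J ∣ ≤ m
    Indep⇒≤rank J (B , b , J⊆B) = subst (∣ J ∣ ≤_) (rank B b) (p⊆q⇒∣p∣≤∣q∣ J⊆B)

    augment : ∀ {I J} → Indep (Base M) I → Indep (Base M) J → ∣ I ∣ < ∣ J ∣ →
      ∃ λ y → y ∈ J × y ∉ I × Indep (Base M) (I ∪ ⁅ y ⁆)
    augment {I} {J} (B₁ , b₁ , I⊆B₁) (B₂ , b₂ , J⊆B₂) ∣I∣<∣J∣ with basis-between b₁ b₂ I⊆B₁
    ... | B , b , I⊆B , B⊆I∪B₂ with ⊆-or-∃∉ (B ∩ J) I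
    ... | inj₂ (y , y∈B∩J , y∉I) = y , p∩q⊆q B J y∈B∩J , y∉I , B , b , p∪⁅x⁆⊆q I⊆B (p∩q⊆p B J y∈B∩J)
    ... | inj₁ B∩J⊆I = contradiction ∣J∣≤∣I∣ (<⇒≱ ∣I∣<∣J∣)
      where
      B⊆I∪[B₂─J] : B ⊆ I ∪ (B₂ ─ J)
      B⊆I∪[B₂─J] {z} z∈B with x∈p∪q⁻ I B₂ (B⊆I∪B₂ z∈B) | z ∈? J
      ... | inj₁ z∈I  | _       = p⊆p∪q _ z∈I
      ... | inj₂ _    | yes z∈J = p⊆p∪q _ (B∩J⊆I (x∈p∩q⁺ (z∈B , z∈J)))
      ... | inj₂ z∈B₂ | no  z∉J = q⊆p∪q I _ (x∈p∧x∉q⇒x∈p─q z∈B₂ z∉J)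
      ∣J∣≤∣I∣ : ∣ J ∣ ≤ ∣ I ∣
      ∣J∣≤∣I∣ = +-cancelʳ-≤ (∣ B₂ ─ J ∣) (∣ J ∣) (∣ I ∣) (begin
        ∣ J ∣ + ∣ B₂ ─ J ∣           ≤⟨ +-monoˡ-≤ _ (p⊆q⇒∣p∣≤∣q∣ (λ z∈J → x∈p∩q⁺ (J⊆B₂ z∈J , z∈J))) ⟩
        ∣ B₂ ∩ J ∣ + ∣ B₂ ─ J ∣      ≡⟨ ∣p∣≡∣p∩q∣+∣p─q∣ B₂ J ⟨
        ∣ B₂ ∣                      ≡⟨ trans (rank B₂ b₂) (sym (rank B b)) ⟩
        ∣ B ∣                       ≤⟨ p⊆q⇒∣p∣≤∣q∣ B⊆I∪[B₂─J] ⟩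
        ∣ I ∪ (B₂ ─ J) ∣             ≤⟨ ∣p∪q∣≤∣p∣+∣q∣ I (B₂ ─ J) ⟩
        ∣ I ∣ + ∣ B₂ ─ J ∣           ∎)
        where open ≤-Reasoning

    RankBound-insert-dependent : ∀ {A T e} → Indep (Base M) T → T ⊆ A → ∣ T ∣ ≡ r →
      RankBound (Base M) A r → ¬ Indep (Base M) (T ∪ ⁅ e ⁆) → RankBound (Base M) (A ∪ ⁅ e ⁆) r
    RankBound-insert-dependent {r = r} {A} {T} i T⊆A ∣T∣≡r bound-A dep J j J⊆A∪e with ∣ J ∣ ≤? r
    ... | yes ∣J∣≤r = ∣J∣≤r
    ... | no  ∣J∣≰r with augment i j (subst (_< ∣ J ∣) (sym ∣T∣≡r) (≰⇒> ∣J∣≰r))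
    ... | y , y∈J , y∉T , i′ with x∈p∪⁅y⁆⁻ A (J⊆A∪e y∈J)
    ... | inj₂ refl = contradiction i′ dep
    ... | inj₁ y∈A  = contradiction
      (subst (_≤ r) (trans (∣p∪⁅x⁆∣≡1+∣p∣ T y∉T) (cong suc ∣T∣≡r)) (bound-A _ i′ (p∪⁅x⁆⊆q T⊆A y∈A)))
      (n≮n r)

    flat-insert-independent : ∀ {A T e} → IsFlat (Base M) A → Indep (Base M) T → T ⊆ A → ∣ T ∣ ≡ r →
      RankBound (Base M) A r → e ∉ A → Indep (Base M) (T ∪ ⁅ e ⁆)
    flat-insert-independent {T = T} {e} flat i T⊆A ∣T∣≡r bound-A e∉A with Indep? (T ∪ ⁅ e ⁆)
    ... | yes i′ = i′
    ... | no dep = ⊥-elim (flat _ e∉A _ ((T , i , T⊆A , ∣T∣≡r) , bound-A)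
      ((T , i , ⊆-trans T⊆A (p⊆p∪q _) , ∣T∣≡r) , RankBound-insert-dependent i T⊆A ∣T∣≡r bound-A dep))

module Relaxation (M : Matroid n) (k : ℕ) (H : Subset n) (rank : HasRank M (suc k))
                  (stressed : IsStressedHyperplane M k H) where

  private
    𝓑 𝓑̃ : Family n
    𝓑 = Base M
    𝓑̃ = RelaxedBases M k H

  NewBasis : Subset n → Set
  NewBasis S = S ⊆ H × ∣ S ∣ ≡ suc k

  ContainsNewBasis : Subset n → Set
  ContainsNewBasis X = ∃ λ S → S ⊆ X × NewBasis S

  containsNewBasis? : Decidable ContainsNewBasis
  containsNewBasis? X = anySubset? λ S → S ⊆? X ×-dec (S ⊆? H ×-dec (∣ S ∣ ≟ suc k))

  H-flat : IsFlat 𝓑 H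
  H-flat = proj₁ (proj₁ stressed)

  H-rank : HasRankOf 𝓑 H k
  H-rank = proj₂ (proj₁ stressed)

  NewBasis⇒Dependent : ∀ {S} → NewBasis S → ¬ Indep 𝓑 S
  NewBasis⇒Dependent (S⊆H , ∣S∣≡1+k) = proj₁ (proj₂ stressed _ S⊆H ∣S∣≡1+k)

  ⊂NewBasis⇒Indep : ∀ {S J} → NewBasis S → J ⊂ S → Indep 𝓑 J
  ⊂NewBasis⇒Indep (S⊆H , ∣S∣≡1+k) = proj₂ (proj₂ stressed _ S⊆H ∣S∣≡1+k) _

  ∣NewBasis-x∣≡k : ∀ {S x} → NewBasis S → x ∈ S → ∣ S - x ∣ ≡ k
  ∣NewBasis-x∣≡k {S} (_ , ∣S∣≡1+k) x∈S = suc-injective (trans (∣p-x∣+1≡∣p∣ S x∈S) ∣S∣≡1+k)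

  NewBasis-insert : ∀ {T x} → T ⊆ H → ∣ T ∣ ≡ k → x ∈ H → x ∉ T → NewBasis (T ∪ ⁅ x ⁆)
  NewBasis-insert {T} T⊆H ∣T∣≡k x∈H x∉T =
    p∪⁅x⁆⊆q T⊆H x∈H , trans (∣p∪⁅x⁆∣≡1+∣p∣ T x∉T) (cong suc ∣T∣≡k)

  Indep⇒Indep̃ : ∀ {J} → Indep 𝓑 J → Indep 𝓑̃ J
  Indep⇒Indep̃ (B , b , J⊆B) = B , inj₁ b , J⊆B

  NewBasis⇒Indep̃ : ∀ {S} → NewBasis S → Indep 𝓑̃ S
  NewBasis⇒Indep̃ nb = _ , inj₂ nb , ⊆-refl

  Indep̃⇒Indep⊎NewBasis : ∀ {J} → Indep 𝓑̃ J → Indep 𝓑 J ⊎ NewBasis J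
  Indep̃⇒Indep⊎NewBasis (B , inj₁ b , J⊆B) = inj₁ (B , b , J⊆B)
  Indep̃⇒Indep⊎NewBasis {J} (B , inj₂ (B⊆H , ∣B∣≡1+k) , J⊆B) with ⊆-or-∃∉ B J
  ... | inj₁ B⊆J = inj₂ (⊆-trans J⊆B B⊆H ,
    trans (≤-antisym (p⊆q⇒∣p∣≤∣q∣ J⊆B) (p⊆q⇒∣p∣≤∣q∣ B⊆J)) ∣B∣≡1+k)
  ... | inj₂ x∈B∖J = inj₁ (⊂NewBasis⇒Indep (B⊆H , ∣B∣≡1+k) (J⊆B , x∈B∖J))

  Indep̃⇒≤rank : ∀ J → Indep 𝓑̃ J → ∣ J ∣ ≤ suc k
  Indep̃⇒≤rank J j̃ with Indep̃⇒Indep⊎NewBasis j̃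
  ... | inj₁ j               = Indep⇒≤rank M rank J j
  ... | inj₂ (_ , ∣J∣≡1+k) = ≤-reflexive ∣J∣≡1+k

  Indep̃⇒Indep-within : ∀ {X J} → ¬ ContainsNewBasis X → J ⊆ X → Indep 𝓑̃ J → Indep 𝓑 J
  Indep̃⇒Indep-within noNew J⊆X j̃ with Indep̃⇒Indep⊎NewBasis j̃
  ... | inj₁ j  = j
  ... | inj₂ nb = ⊥-elim (noNew (_ , J⊆X , nb))

  k-subset-Indep : ∀ {A} → A ⊆ H → ∣ A ∣ ≡ k → Indep 𝓑 A
  k-subset-Indep {A} A⊆H ∣A∣≡k with ⊆-or-∃∉ H A
  ... | inj₂ (h , h∈H , h∉A) =
    ⊂NewBasis⇒Indep (NewBasis-insert A⊆H ∣A∣≡k h∈H h∉A) (p⊆p∪q _ , h , x∈p∪⁅x⁆ A , h∉A)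
  ... | inj₁ H⊆A with proj₁ H-rank
  ...   | I , i , I⊆H , ∣I∣≡k =
    Indep-⊆ 𝓑 i (p⊆q∧∣q∣≤∣p∣⇒q⊆p (⊆-trans I⊆H H⊆A) (≤-reflexive (trans ∣A∣≡k (sym ∣I∣≡k))))

  insert-outside-H-Indep : ∀ {T a} → Indep 𝓑 T → T ⊆ H → ∣ T ∣ ≡ k → a ∉ H → Indep 𝓑 (T ∪ ⁅ a ⁆)
  insert-outside-H-Indep i T⊆H ∣T∣≡k = flat-insert-independent M rank H-flat i T⊆H ∣T∣≡k (proj₂ H-rank)

  ∃∉H : ∃ λ e → e ∉ H
  ∃∉H with base-exists M
  ... | B , b with ⊆-or-∃∉ B H
  ...   | inj₂ (e , _ , e∉H) = e , e∉H
  ...   | inj₁ B⊆H = ⊥-elim (n≮n k (subst (_≤ k) (rank B b) (proj₂ H-rank B (B , b , ⊆-refl) B⊆H)))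

  proper-flat-containing-NewBasis≡H : ∀ {A S e} → IsFlat 𝓑 A → e ∉ A → S ⊆ A → NewBasis S → A ≡ H
  proper-flat-containing-NewBasis≡H {A} {S} flat e∉A S⊆A nb with ∣p∣≡1+m⇒Nonempty S (proj₂ nb)
  ... | x , x∈S = ⊆-antisym (flat-⊆-maximal 𝓑 H-flat H-rank H⊆A bound-A) H⊆A
    where
    bound-A : RankBound 𝓑 A k
    bound-A = proper-flat-rank-bound 𝓑 (Indep⇒≤rank M rank) flat e∉A
    S-x⊆S : S - x ⊆ S
    S-x⊆S = p─q⊆p S ⁅ x ⁆
    H⊆A : H ⊆ A
    H⊆A {h} h∈H with h ∈? A
    ... | yes h∈A = h∈A
    ... | no  h∉A = ⊥-elim (NewBasis⇒Dependent
      (NewBasis-insert (⊆-trans S-x⊆S (proj₁ nb)) (∣NewBasis-x∣≡k nb x∈S) h∈H (h∉A ∘ S⊆A ∘ S-x⊆S))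
      (flat-insert-independent M rank flat (⊂NewBasis⇒Indep nb (x∈p⇒p-x⊂p x∈S)) (⊆-trans S-x⊆S S⊆A)
        (∣NewBasis-x∣≡k nb x∈S) bound-A h∉A))

  k-subset-extends : ∀ {A T} → ¬ ContainsNewBasis A → ¬ (A ⊆ H × ∣ A ∣ ≡ k) →
    Indep 𝓑 T → T ⊆ A → T ⊆ H → ∣ T ∣ ≡ k → ∃ λ I → Indep 𝓑 I × I ⊆ A × ∣ I ∣ ≡ suc k
  k-subset-extends {A} {T} noNew notK i T⊆A T⊆H ∣T∣≡k with ⊆-or-∃∉ A T
  ... | inj₁ A⊆T = ⊥-elim (notK (⊆-trans A⊆T T⊆H , subst (λ X → ∣ X ∣ ≡ k) (⊆-antisym T⊆A A⊆T) ∣T∣≡k))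
  ... | inj₂ (a , a∈A , a∉T) with a ∈? H
  ...   | yes a∈H = ⊥-elim (noNew (_ , p∪⁅x⁆⊆q T⊆A a∈A , NewBasis-insert T⊆H ∣T∣≡k a∈H a∉T))
  ...   | no  a∉H = _ , insert-outside-H-Indep i T⊆H ∣T∣≡k a∉H , p∪⁅x⁆⊆q T⊆A a∈A ,
                    trans (∣p∪⁅x⁆∣≡1+∣p∣ T a∉T) (cong suc ∣T∣≡k)

  k-subset-not-flat : ∀ A → A ⊆ H → ∣ A ∣ ≡ k → ¬ (IsFlat 𝓑 A × A ≢ H)
  k-subset-not-flat A A⊆H ∣A∣≡k (flat , A≢H) with ⊆-or-∃∉ H A
  ... | inj₁ H⊆A = A≢H (⊆-antisym A⊆H H⊆A)
  ... | inj₂ (h , h∈H , h∉A) = flat h h∉A k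
    ((A , i , ⊆-refl , ∣A∣≡k) , λ J _ J⊆A → subst (∣ J ∣ ≤_) ∣A∣≡k (p⊆q⇒∣p∣≤∣q∣ J⊆A))
    ((A , i , p⊆p∪q _ , ∣A∣≡k) , λ J j J⊆A∪h → proj₂ H-rank J j (⊆-trans J⊆A∪h (p∪⁅x⁆⊆q A⊆H h∈H)))
    where i = k-subset-Indep A⊆H ∣A∣≡k

  k-subset-relaxed-flat : ∀ {A} → A ⊆ H → ∣ A ∣ ≡ k → IsFlat 𝓑̃ A
  k-subset-relaxed-flat A⊆H ∣A∣≡k = IsFlat-if-insertions-independent 𝓑̃ λ e e∉A → insert e e∉A
    where
    insert : ∀ e → e ∉ _ → Indep 𝓑̃ _
    insert e e∉A with e ∈? H
    ... | yes e∈H = NewBasis⇒Indep̃ (NewBasis-insert A⊆H ∣A∣≡k e∈H e∉A)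
    ... | no  e∉H = Indep⇒Indep̃ (insert-outside-H-Indep (k-subset-Indep A⊆H ∣A∣≡k) A⊆H ∣A∣≡k e∉H)

  flat⇒relaxed-flat : ∀ {A} → IsFlat 𝓑 A → A ≢ H → IsFlat 𝓑̃ A
  flat⇒relaxed-flat {A} flat A≢H e e∉A r rank̃-A ((I , ĩ , I⊆A∪e , ∣I∣≡r) , bound̃-A∪e)
    with containsNewBasis? A
  ... | yes (S , S⊆A , nb) = A≢H (proper-flat-containing-NewBasis≡H flat e∉A S⊆A nb)
  ... | no  noNew = flat e e∉A r rank-A ((I , i , I⊆A∪e , ∣I∣≡r) , λ J j → bound̃-A∪e J (Indep⇒Indep̃ j))
    where
    rank-A : HasRankOf 𝓑 A r
    rank-A = HasRankOf-transfer (λ J⊆A → Indep̃⇒Indep-within noNew J⊆A) (λ _ → Indep⇒Indep̃) rank̃-A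
    i : Indep 𝓑 I
    i with Indep̃⇒Indep⊎NewBasis ĩ | proj₁ rank-A
    ... | inj₁ j | _ = j
    ... | inj₂ (_ , ∣I∣≡1+k) | I′ , i′ , I′⊆A , ∣I′∣≡r = ⊥-elim (n≮n k (begin-strict
      k          <⟨ n<1+n k ⟩
      suc k      ≡⟨ trans (sym ∣I∣≡1+k) (trans ∣I∣≡r (sym ∣I′∣≡r)) ⟩
      ∣ I′ ∣      ≤⟨ proper-flat-rank-bound 𝓑 (Indep⇒≤rank M rank) flat e∉A I′ i′ I′⊆A ⟩
      k          ∎))
      where open ≤-Reasoning

  relaxed-flat⇒flat : ∀ {A} → IsFlat 𝓑̃ A → ¬ (A ⊆ H × ∣ A ∣ ≡ k) → IsFlat 𝓑 A
  relaxed-flat⇒flat {A} flat̃ notK e e∉A r rank-A ((I , i , I⊆A∪e , ∣I∣≡r) , bound-A∪e)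
    with containsNewBasis? A
  ... | yes (S , S⊆A , nb) =
    ¬IsFlat-if-spanning 𝓑̃ Indep̃⇒≤rank (NewBasis⇒Indep̃ nb) S⊆A (proj₂ nb) e∉A flat̃
  ... | no  noNew = flat̃ e e∉A r
    (HasRankOf-transfer (λ _ → Indep⇒Indep̃) (λ J⊆A → Indep̃⇒Indep-within noNew J⊆A) rank-A)
    ((I , Indep⇒Indep̃ i , I⊆A∪e , ∣I∣≡r) , bound̃-A∪e)
    where
    bound̃-A∪e : RankBound 𝓑̃ (A ∪ ⁅ e ⁆) r
    bound̃-A∪e J j̃ J⊆A∪e with Indep̃⇒Indep⊎NewBasis j̃
    ... | inj₁ j = bound-A∪e J j J⊆A∪e
    ... | inj₂ nb with e ∈? J
    ...   | no  e∉J = ⊥-elim (noNew (J , p⊆q∪⁅x⁆∧x∉p⇒p⊆q J⊆A∪e e∉J , nb))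
    ...   | yes e∈J with k-subset-extends noNew notK (⊂NewBasis⇒Indep nb (x∈p⇒p-x⊂p e∈J))
                         (p⊆q∪⁅x⁆⇒p-x⊆q J J⊆A∪e) (⊆-trans (p─q⊆p J _) (proj₁ nb)) (∣NewBasis-x∣≡k nb e∈J)
    ...     | I′ , i′ , I′⊆A , ∣I′∣≡1+k =
      subst (_≤ r) (trans ∣I′∣≡1+k (sym (proj₂ nb))) (proj₂ rank-A I′ i′ I′⊆A)

  relaxed-flat-H⇒∣H∣≡k : IsFlat 𝓑̃ H → ∣ H ∣ ≡ k
  relaxed-flat-H⇒∣H∣≡k flat̃ with proj₁ H-rank
  ... | I , _ , I⊆H , ∣I∣≡k with ⊆-or-∃∉ H I
  ...   | inj₁ H⊆I = ≤-antisym (subst (∣ H ∣ ≤_) ∣I∣≡k (p⊆q⇒∣p∣≤∣q∣ H⊆I))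
                               (subst (_≤ ∣ H ∣) ∣I∣≡k (p⊆q⇒∣p∣≤∣q∣ I⊆H))
  ...   | inj₂ (h , h∈H , h∉I) = ⊥-elim (¬IsFlat-if-spanning 𝓑̃ Indep̃⇒≤rank (NewBasis⇒Indep̃ nb)
          (proj₁ nb) (proj₂ nb) (proj₂ ∃∉H) flat̃)
    where nb = NewBasis-insert I⊆H ∣I∣≡k h∈H h∉I

proposition3p10 : ∀ {n} (M : Matroid n) (k : ℕ) (H : Subset n) →
    HasRank M (suc k) → IsStressedHyperplane M k H →
    (∀ A → IsFlat (RelaxedBases M k H) A ⇔ ((IsFlat (Base M) A × A ≢ H) ⊎ (A ⊆ H × ∣ A ∣ ≡ k)))
    × (∀ A → A ⊆ H → ∣ A ∣ ≡ k → ¬ (IsFlat (Base M) A × A ≢ H))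
proposition3p10 M k H rank stressed = (λ A → mk⇔ (forward A) (backward A)) , k-subset-not-flat
  where
  open Relaxation M k H rank stressed

  forward : ∀ A → IsFlat (RelaxedBases M k H) A → (IsFlat (Base M) A × A ≢ H) ⊎ (A ⊆ H × ∣ A ∣ ≡ k)
  forward A flat̃ with A ⊆? H ×-dec (∣ A ∣ ≟ k)
  ... | yes k-subset = inj₂ k-subset
  ... | no  notK     = inj₁ (relaxed-flat⇒flat flat̃ notK ,
                             λ { refl → notK (⊆-refl , relaxed-flat-H⇒∣H∣≡k flat̃) })

  backward : ∀ A → (IsFlat (Base M) A × A ≢ H) ⊎ (A ⊆ H × ∣ A ∣ ≡ k) → IsFlat (RelaxedBases M k H) A
  backward A (inj₁ (flat , A≢H))   = flat⇒relaxed-flat flat A≢H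
  backward A (inj₂ (A⊆H , ∣A∣≡k)) = k-subset-relaxed-flat A⊆H ∣A∣≡k
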